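{- Let $G$ be a graph of maximum degree $\Delta$ with an almost-clique decomposition, and let $C$ be a difficult almost-clique with level $\ell(C)<\infty$. Let $C'$ be the difficult almost-clique containing the special node $s_C$ of $C$. Then $\ell(C)<\ell(C')$.
   Context: An almost-clique decomposition (ACD) with parameter $\varepsilon$ (here $\varepsilon=1/172$) partitions the node set $V$ into $V_{sparse}$ and disjoint sets $C_1,\dots,C_t$ called almost-cliques (ACs) with $(1-\varepsilon/4)\Delta\le|C_i|\le(1+\varepsilon)\Delta$, every $v\in C_i$ having at least $(1-\varepsilon)\Delta$ neighbors in $C_i$, and every $u\notin C_i$ having at most $(1-\varepsilon/2)\Delta$ neighbors in $C_i$. For an AC $C$ let $e_C=\Delta-|C|+1$. An AC is easy if it contains two non-adjacent nodes or a node of degree less than $\Delta$. A node $v\notin C$ is an intrusive neighbor of a non-easy AC $C$ if $v$ has at least $2e_C$ neighbors in $C$. A non-easy AC is difficult if it has an intrusive neighbor; each difficult AC $C$ arbitrarily selects one of its intrusive neighbors as its special node $s_C$. Levels: a difficult AC $C$ has level $\ell(C)=\infty$ if its special node $s_C$ is not contained in any difficult AC; otherwise $\ell(C)=\lceil\log_2 e_C\rceil$. -}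

module Defs where

open import Data.Nat using (ℕ; zero; suc; _+_; _*_; _∸_; _≤_; _<_)
open import Data.Nat.Logarithm using (⌈log₂_⌉)
open import Data.Bool using (Bool; true; false; if_then_else_; _∧_)
open import Data.Fin using (Fin) renaming (zero to fz; suc to fs)
import Data.Fin as F
open import Data.Maybe using (Maybe; just; nothing)
open import Data.Product using (Σ; ∃; _×_; _,_)
open import Data.Sum using (_⊎_)
open import Data.Empty using (⊥)
open import Relation.Nullary using (¬_; does)
open import Relation.Binary.PropositionalEquality using (_≡_; _≢_)

count : ∀ {n} → (Fin n → Bool) → ℕ
count {zero}  p = 0
count {suc n} p = (if p fz then 1 else 0) + count (λ x → p (fs x))

record Graph (n : ℕ) : Set where
  field
    adj    : Fin n → Fin n → Bool
    sym    : ∀ u v → adj u v ≡ adj v u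
    irrefl : ∀ v → adj v v ≡ false

open Graph public

deg : ∀ {n} → Graph n → Fin n → ℕ
deg G v = count (adj G v)

MaxDegree : ∀ {n} → Graph n → ℕ → Set
MaxDegree G Δ = (∀ v → deg G v ≤ Δ) × (∃ λ v → deg G v ≡ Δ)

isJust≡ : ∀ {t} → Maybe (Fin t) → Fin t → Bool
isJust≡ nothing  i = false
isJust≡ (just j) i = does (j F.≟ i)

-- A partition of V into V_sparse and C_1..C_t is given by a map
-- acOf : Fin n → Maybe (Fin t); nothing = V_sparse, just i = in C_i.
module _ {n t : ℕ} (G : Graph n) (acOf : Fin n → Maybe (Fin t)) where

  InAC : Fin t → Fin n → Set
  InAC i v = acOf v ≡ just i

  inACb : Fin t → Fin n → Bool
  inACb i v = isJust≡ (acOf v) i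

  size : Fin t → ℕ
  size i = count (inACb i)

  degIn : Fin t → Fin n → ℕ
  degIn i v = count (λ u → adj G v u ∧ inACb i u)

  -- ACD with ε = 1/172 (inequalities multiplied out by denominators):
  --  (1-ε/4)Δ ≤ |C|        ⇔ 687Δ ≤ 688|C|
  --  |C| ≤ (1+ε)Δ          ⇔ 172|C| ≤ 173Δ
  --  deg_C(v) ≥ (1-ε)Δ      ⇔ 171Δ ≤ 172 deg_C(v)
  --  deg_C(u) ≤ (1-ε/2)Δ    ⇔ 344 deg_C(u) ≤ 343Δ
  record IsACD (Δ : ℕ) : Set where
    field
      sizeLower : ∀ i → 687 * Δ ≤ 688 * size i
      sizeUpper : ∀ i → 172 * size i ≤ 173 * Δ
      inner     : ∀ i v → InAC i v → 171 * Δ ≤ 172 * degIn i v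
      outer     : ∀ i u → ¬ InAC i u → 344 * degIn i u ≤ 343 * Δ

  module _ (Δ : ℕ) where

    eC : Fin t → ℕ
    eC i = suc Δ ∸ size i

    Easy : Fin t → Set
    Easy i = (Σ (Fin n) λ u → Σ (Fin n) λ v →
                 InAC i u × InAC i v × u ≢ v × adj G u v ≡ false)
           ⊎ (Σ (Fin n) λ v → InAC i v × deg G v < Δ)

    Intrusive : Fin t → Fin n → Set
    Intrusive i v = ¬ InAC i v × 1 ≤ degIn i v × 2 * eC i ≤ degIn i v

    Difficult : Fin t → Set
    Difficult i = ¬ Easy i × ∃ λ v → Intrusive i v

    InDifficult : Fin n → Set
    InDifficult v = Σ (Fin t) λ k → InAC k v × Difficult k

    SpecialChoice : Set
    SpecialChoice = Σ (Fin t → Fin n) λ s → ∀ i → Difficult i → Intrusive i (s i)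

data ℕ∞ : Set where
  fin : ℕ → ℕ∞
  ∞   : ℕ∞

data _<∞_ : ℕ∞ → ℕ∞ → Set where
  fin<fin : ∀ {a b} → a < b → fin a <∞ fin b
  fin<∞   : ∀ {a} → fin a <∞ ∞

data LevelIs {n t : ℕ} (G : Graph n) (acOf : Fin n → Maybe (Fin t)) (Δ : ℕ)
             (s : Fin t → Fin n) (i : Fin t) : ℕ∞ → Set where
  level∞   : ¬ InDifficult G acOf Δ (s i) → LevelIs G acOf Δ s i ∞
  levelFin : InDifficult G acOf Δ (s i) →
             LevelIs G acOf Δ s i (fin ⌈log₂ eC G acOf Δ i ⌉)

-- The special node s of C lies in the clique C', so it is adjacent to the other |C'| − 1
-- nodes of C' and has at most Δ − |C'| + 1 = e_{C'} neighbours outside C'; all of its at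
-- least 2e_C neighbours in C are among them, so 2e_C ≤ e_{C'}. A neighbour u ∈ C of s has
-- the outside neighbour s, so by the same count e_C ≥ 1, and ⌈log₂⌉ strictly increases
-- when a positive number is doubled.
module Submission where

open import Defs hiding (sym)
open import Data.Nat using (ℕ; zero; suc; _+_; _*_; _≤_; _<_; z≤n; s≤s)
open import Data.Nat.Properties
open import Data.Nat.Logarithm using (⌈log₂_⌉; ⌈log₂⌉-mono-≤; ⌈log₂2*n⌉≡1+⌈log₂n⌉)
open import Data.Bool using (Bool; true; false; _∧_; not)
open import Data.Fin using (Fin) renaming (zero to fz; suc to fs)
import Data.Fin as F
open import Data.Fin.Properties using () renaming (suc-injective to fsuc-injective)
open import Data.Maybe using (Maybe; just)
open import Data.Maybe.Properties using (just-injective)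
open import Data.Product using (Σ; proj₁; _,_)
open import Data.Sum using (_⊎_; inj₁; inj₂)
open import Relation.Nullary using (¬_; does; yes; no; contradiction)
open import Relation.Binary.PropositionalEquality
  using (_≡_; refl; sym; trans; cong; subst; _≢_)

∧-true⇒ˡ : ∀ {a b} → (a ∧ b) ≡ true → a ≡ true
∧-true⇒ˡ {true} _ = refl

∧-true⇒ʳ : ∀ {a b} → (a ∧ b) ≡ true → b ≡ true
∧-true⇒ʳ {true} e = e

∧-true : ∀ {a b} → a ≡ true → b ≡ true → (a ∧ b) ≡ true
∧-true refl refl = refl

not-false : ∀ {b} → b ≡ false → not b ≡ true
not-false refl = refl

not-true-false : ∀ {b} → b ≡ true → not b ≢ true
not-true-false refl ()

does-≟⇒≡ : ∀ {n} (u v : Fin n) → does (u F.≟ v) ≡ true → u ≡ v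
does-≟⇒≡ u v e with u F.≟ v
... | yes u≡v = u≡v

count-false : ∀ {n} (p : Fin n → Bool) → (∀ x → p x ≡ false) → count p ≡ 0
count-false {zero}  p h = refl
count-false {suc n} p h rewrite h fz = count-false (λ x → p (fs x)) (λ x → h (fs x))

count-pos : ∀ {n} (p : Fin n → Bool) x → p x ≡ true → 1 ≤ count p
count-pos p fz e rewrite e = s≤s z≤n
count-pos {suc n} p (fs x) e = ≤-trans (count-pos (λ y → p (fs y)) x e) (m≤n+m _ _)

count-witness : ∀ {n} (p : Fin n → Bool) → 1 ≤ count p → Σ (Fin n) λ x → p x ≡ true
count-witness {suc n} p h with p fz in e
... | true  = fz , e
... | false with count-witness (λ x → p (fs x)) h
...   | x , ex = fs x , ex

count-mono : ∀ {n} (p q : Fin n → Bool) → (∀ x → p x ≡ true → q x ≡ true) →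
             count p ≤ count q
count-mono {zero}  p q h = z≤n
count-mono {suc n} p q h
  with p fz in ep | q fz in eq | count-mono (λ x → p (fs x)) (λ x → q (fs x)) (λ x → h (fs x))
... | false | false | rec = rec
... | false | true  | rec = m≤n⇒m≤1+n rec
... | true  | true  | rec = s≤s rec
... | true  | false | _   = contradiction (trans (sym eq) (h fz ep)) λ ()

count-≤1 : ∀ {n} (p : Fin n → Bool) → (∀ x y → p x ≡ true → p y ≡ true → x ≡ y) →
           count p ≤ 1
count-≤1 {zero}  p h = z≤n
count-≤1 {suc n} p h with p fz in e
... | true  = ≤-reflexive (cong suc (count-false _ rest-false))
  where
  rest-false : ∀ x → p (fs x) ≡ false
  rest-false x with p (fs x) in ex
  ... | false = refl
  ... | true  with () ← h fz (fs x) e ex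
... | false = count-≤1 (λ x → p (fs x)) λ x y px py →
                fsuc-injective (h (fs x) (fs y) px py)

count-split : ∀ {n} (p b : Fin n → Bool) →
              count p ≡ count (λ x → p x ∧ b x) + count (λ x → p x ∧ not (b x))
count-split {zero}  p b = refl
count-split {suc n} p b with p fz | b fz
... | false | _     = count-split (λ x → p (fs x)) (λ x → b (fs x))
... | true  | true  = cong suc (count-split (λ x → p (fs x)) (λ x → b (fs x)))
... | true  | false = trans (cong suc (count-split (λ x → p (fs x)) (λ x → b (fs x))))
                           (sym (+-suc _ _))

count-union : ∀ {n} (p q r : Fin n → Bool) →
              (∀ x → p x ≡ true → q x ≡ true ⊎ r x ≡ true) →
              count p ≤ count q + count r
count-union p q r h = subst (_≤ count q + count r) (sym (count-split p q))
  (+-mono-≤ (count-mono _ q (λ x → ∧-true⇒ʳ)) (count-mono _ r outside-q⇒r))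
  where
  outside-q⇒r : ∀ x → (p x ∧ not (q x)) ≡ true → r x ≡ true
  outside-q⇒r x e with h x (∧-true⇒ˡ e)
  ... | inj₁ qx = contradiction (∧-true⇒ʳ e) (not-true-false qx)
  ... | inj₂ rx = rx

isJust≡⇒≡just : ∀ {t} (m : Maybe (Fin t)) i → isJust≡ m i ≡ true → m ≡ just i
isJust≡⇒≡just (just j) i e = cong just (does-≟⇒≡ j i e)

⌈log₂⌉-double-< : ∀ a b → 1 ≤ a → 2 * a ≤ b → ⌈log₂ a ⌉ < ⌈log₂ b ⌉
⌈log₂⌉-double-< (suc a) b _ 2a≤b =
  subst (_≤ ⌈log₂ b ⌉) (⌈log₂2*n⌉≡1+⌈log₂n⌉ (suc a)) (⌈log₂⌉-mono-≤ 2a≤b)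

module _ {n t : ℕ} (G : Graph n) (acOf : Fin n → Maybe (Fin t)) (Δ : ℕ) where

  private
    inAC : Fin t → Fin n → Bool
    inAC = inACb G acOf

  degOut : Fin t → Fin n → ℕ
  degOut k v = count (λ u → adj G v u ∧ not (inAC k u))

  inACb⇒InAC : ∀ {k v} → inAC k v ≡ true → InAC G acOf k v
  inACb⇒InAC {k} {v} = isJust≡⇒≡just (acOf v) k

  ¬InAC⇒inACb-false : ∀ {k v} → ¬ InAC G acOf k v → inAC k v ≡ false
  ¬InAC⇒inACb-false {k} {v} v∉k with inAC k v in e
  ... | false = refl
  ... | true  = contradiction (inACb⇒InAC e) v∉k

  deg≡degIn+degOut : ∀ k v → deg G v ≡ degIn G acOf k v + degOut k v
  deg≡degIn+degOut k v = count-split (adj G v) (inAC k)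

  non-easy⇒adjacent : ∀ {k} → ¬ Easy G acOf Δ k → ∀ {u v} →
                      InAC G acOf k u → InAC G acOf k v → u ≢ v → adj G u v ≡ true
  non-easy⇒adjacent ¬easy {u} {v} u∈k v∈k u≢v with adj G u v in e
  ... | true  = refl
  ... | false = contradiction (inj₁ (u , v , u∈k , v∈k , u≢v , e)) ¬easy

  size≤1+degIn : ∀ {k} → ¬ Easy G acOf Δ k → ∀ {v} → InAC G acOf k v →
                 size G acOf k ≤ 1 + degIn G acOf k v
  size≤1+degIn {k} ¬easy {v} v∈k =
    ≤-trans (count-union _ (λ x → does (v F.≟ x)) _ self-or-neighbour)
            (+-monoˡ-≤ _ (count-≤1 _ λ x y vx vy →
              trans (sym (does-≟⇒≡ v x vx)) (does-≟⇒≡ v y vy)))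
    where
    self-or-neighbour : ∀ x → inAC k x ≡ true →
                        does (v F.≟ x) ≡ true ⊎ (adj G v x ∧ inAC k x) ≡ true
    self-or-neighbour x x∈k with v F.≟ x
    ... | yes _   = inj₁ refl
    ... | no  v≢x = inj₂ (∧-true (non-easy⇒adjacent ¬easy v∈k (inACb⇒InAC x∈k) v≢x) x∈k)

  degOut≤eC : MaxDegree G Δ → ∀ {k} → ¬ Easy G acOf Δ k → ∀ {v} → InAC G acOf k v →
              degOut k v ≤ eC G acOf Δ k
  degOut≤eC maxDeg {k} ¬easy {v} v∈k = m+n≤o⇒m≤o∸n (degOut k v) (begin
    degOut k v + size G acOf k                   ≤⟨ +-monoʳ-≤ (degOut k v) (size≤1+degIn ¬easy v∈k) ⟩
    degOut k v + suc (degIn G acOf k v)          ≡⟨ +-suc (degOut k v) _ ⟩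
    suc (degOut k v + degIn G acOf k v)          ≡⟨ cong suc (+-comm (degOut k v) _) ⟩
    suc (degIn G acOf k v + degOut k v)          ≡⟨ cong suc (deg≡degIn+degOut k v) ⟨
    suc (deg G v)                                ≤⟨ s≤s (proj₁ maxDeg v) ⟩
    suc Δ                                        ∎)
    where open ≤-Reasoning

  degIn≤degOut : ∀ {i j} → i ≢ j → ∀ v → degIn G acOf i v ≤ degOut j v
  degIn≤degOut {i} {j} i≢j v = count-mono (λ u → adj G v u ∧ inAC i u) _ λ x e →
    ∧-true (∧-true⇒ˡ e) (not-false (¬InAC⇒inACb-false λ x∈j →
      i≢j (just-injective (trans (sym (inACb⇒InAC (∧-true⇒ʳ e))) x∈j))))

  intrusive⇒eC-pos : MaxDegree G Δ → ∀ {k s} → ¬ Easy G acOf Δ k →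
                     Intrusive G acOf Δ k s → 1 ≤ eC G acOf Δ k
  intrusive⇒eC-pos maxDeg {k} {s} ¬easy (s∉k , has-neighbour , _)
    with u , su∈k ← count-witness _ has-neighbour =
    ≤-trans (count-pos _ s (∧-true (trans (Graph.sym G u s) (∧-true⇒ˡ su∈k))
                                   (not-false (¬InAC⇒inACb-false s∉k))))
            (degOut≤eC maxDeg ¬easy (inACb⇒InAC (∧-true⇒ʳ su∈k)))

  intrusive-in-clique⇒2eC≤eC : MaxDegree G Δ → ∀ {i j s} → ¬ Easy G acOf Δ j →
                               Intrusive G acOf Δ i s → InAC G acOf j s →
                               2 * eC G acOf Δ i ≤ eC G acOf Δ j
  intrusive-in-clique⇒2eC≤eC maxDeg {i} {j} {s} ¬easy (s∉i , _ , 2eC≤degIn) s∈j = begin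
    2 * eC G acOf Δ i   ≤⟨ 2eC≤degIn ⟩
    degIn G acOf i s    ≤⟨ degIn≤degOut (λ { refl → s∉i s∈j }) s ⟩
    degOut j s          ≤⟨ degOut≤eC maxDeg ¬easy s∈j ⟩
    eC G acOf Δ j       ∎
    where open ≤-Reasoning

mainTheorem4 : {n t : ℕ} (G : Graph n) (Δ : ℕ) → MaxDegree G Δ →
    (acOf : Fin n → Maybe (Fin t)) → IsACD G acOf Δ →
    (sc : SpecialChoice G acOf Δ) →
    (i : Fin t) → Difficult G acOf Δ i →
    (j : Fin t) → Difficult G acOf Δ j → acOf (proj₁ sc i) ≡ just j →
    (x y : ℕ∞) → LevelIs G acOf Δ (proj₁ sc) i x → LevelIs G acOf Δ (proj₁ sc) j y →
    x <∞ y
mainTheorem4 G Δ maxDeg acOf _ (s , special) i difficult-i j difficult-j s∈j _ _ = levels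
  where
  levels : ∀ {x y} → LevelIs G acOf Δ s i x → LevelIs G acOf Δ s j y → x <∞ y
  levels (level∞ s∉difficult) _            = contradiction (j , s∈j , difficult-j) s∉difficult
  levels (levelFin _)         (level∞ _)   = fin<∞
  levels (levelFin _)         (levelFin _) = fin<fin (⌈log₂⌉-double-< _ _
    (intrusive⇒eC-pos G acOf Δ maxDeg (proj₁ difficult-i) intrusive)
    (intrusive-in-clique⇒2eC≤eC G acOf Δ maxDeg (proj₁ difficult-j) intrusive s∈j))
    where intrusive = special i difficult-i
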